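{- Let $L$ be a finite geometric lattice of rank $r$, let $\lambda$ be the minimal labeling of $L$ induced by any choice of atom ordering, and let $G_{lex}$ be the directed graph associated to $\lambda$. Then $G_{lex}$ contains a vertex whose distance within $G_{lex}$ (i.e. the minimum length of a directed path in $G_{lex}$) to the unique ascending maximal chain of $L$ is exactly $\binom{r}{2}$.
   Context: A finite lattice is geometric if it is atomic and semimodular; it is graded. For $u\in L$ let $A(u)$ be the set of atoms below $u$. The minimal labeling induced by a total order on atoms assigns to $u\lessdot v$ the label $\lambda(u,v)=\min(A(v)\setminus A(u))$; it is an EL-labeling, so every interval has a unique saturated chain with weakly increasing labels; the ascending chain is the maximal chain with weakly increasing label sequence. $G_{lex}$ has as vertices the maximal chains of $L$ (the facets of the order complex $\Delta(L)$), and has a directed edge $M\to M'$ whenever $M=(\hat0=x_0\lessdot\cdots\lessdot x_r=\hat1)$ has a descent at rank $i$, i.e. $\lambda(x_{i-1},x_i)>\lambda(x_i,x_{i+1})$, and $M'$ is obtained from $M$ by replacing $x_i$ with the unique $y$ such that $x_{i-1}\lessdot y\lessdot x_{i+1}$ and $\lambda(x_{i-1},y)\le\lambda(y,x_{i+1})$. It is an oriented spanning subgraph of the facet-ridge incidence graph of $\Delta(L)$. -}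

module Defs where

open import Data.Nat using (ℕ; zero; suc; _<_) renaming (_≤_ to _≤ℕ_)
open import Data.Fin using (Fin)
open import Data.Product using (Σ; _×_; ∃)
open import Relation.Nullary using (¬_)
open import Relation.Binary.PropositionalEquality using (_≡_; _≢_)
open import Relation.Binary.Lattice.Structures using (IsBoundedLattice)

record FinLattice : Set₁ where
  field
    n   : ℕ
    _≤_ : Fin n → Fin n → Set
    _∨_ : Fin n → Fin n → Fin n
    _∧_ : Fin n → Fin n → Fin n
    ⊤ ⊥ : Fin n
    isBoundedLattice : IsBoundedLattice _≡_ _≤_ _∨_ _∧_ ⊤ ⊥

module _ (L : FinLattice) where
  open FinLattice L

  Elt : Set
  Elt = Fin n

  _<L_ : Elt → Elt → Set
  x <L y = x ≤ y × x ≢ y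

  _⋖_ : Elt → Elt → Set
  x ⋖ y = x <L y × (∀ z → x <L z → z <L y → Data.Empty.⊥)
    where import Data.Empty

  IsAtom : Elt → Set
  IsAtom a = ⊥ ⋖ a

  -- every element is the join (least upper bound) of the atoms below it
  Atomic : Set
  Atomic = ∀ x y → (∀ a → IsAtom a → a ≤ x → a ≤ y) → x ≤ y

  Semimodular : Set
  Semimodular = ∀ a b → (a ∧ b) ⋖ a → b ⋖ (a ∨ b)

  Geometric : Set
  Geometric = Atomic × Semimodular

  -- chains are indexed by ℕ; only indices 0..k are meaningful
  Chain : Set
  Chain = ℕ → Elt

  IsMaxChain : ℕ → Chain → Set
  IsMaxChain k c = (c 0 ≡ ⊥) × (c k ≡ ⊤) × (∀ i → i < k → c i ⋖ c (suc i))

  HasRank : ℕ → Set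
  HasRank r = (Σ Chain (IsMaxChain r)) × (∀ k c → IsMaxChain k c → k ≡ r)

  AtomOrder : (Elt → ℕ) → Set
  AtomOrder ord = ∀ a b → IsAtom a → IsAtom b → ord a ≡ ord b → a ≡ b

  module Labels (ord : Elt → ℕ) where

    Label : Elt → Elt → Elt → Set
    Label u v a = IsAtom a × a ≤ v × ¬ (a ≤ u)
                × (∀ b → IsAtom b → b ≤ v → ¬ (b ≤ u) → ord a ≤ℕ ord b)

    NoDescent : Elt → Elt → Elt → Set
    NoDescent u v w = Σ Elt λ a → Σ Elt λ b → Label u v a × Label v w b × ord a ≤ℕ ord b

    Descent : Elt → Elt → Elt → Set
    Descent u v w = Σ Elt λ a → Σ Elt λ b → Label u v a × Label v w b × ord b < ord a

    module Graph (r : ℕ) where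

      SameChain : Chain → Chain → Set
      SameChain M N = ∀ k → k ≤ℕ r → M k ≡ N k

      -- edge M → M' of G_lex: M has a descent at rank i = suc j (0 < i < r),
      -- M' is a maximal chain agreeing with M except at rank i, with no
      -- descent at rank i
      Edge : Chain → Chain → Set
      Edge M M' = Σ ℕ λ j → (suc (suc j) ≤ℕ r)
        × Descent (M j) (M (suc j)) (M (suc (suc j)))
        × IsMaxChain r M'
        × (∀ k → k ≤ℕ r → k ≢ suc j → M' k ≡ M k)
        × NoDescent (M j) (M' (suc j)) (M (suc (suc j)))

      data Path : Chain → Chain → ℕ → Set where
        here : ∀ {M N} → SameChain M N → Path M N 0
        step : ∀ {M M' N k} → Edge M M' → Path M' N k → Path M N (suc k)

      Dist : Chain → Chain → ℕ → Set
      Dist M N d = Path M N d × (∀ k → Path M N k → d ≤ℕ k)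

      Ascending : Chain → Set
      Ascending A = IsMaxChain r A
        × (∀ i → suc (suc i) ≤ℕ r → NoDescent (A i) (A (suc i)) (A (suc (suc i))))

{-# OPTIONS --safe #-}
-- Let a 0, …, a (r-1) be the labels of the ascending chain A, built greedily: a k is the least
-- atom not below A k. In a geometric lattice these atoms are independent, so for every
-- permutation σ of {0, …, r-1} the joins J σ k = a (σ 0) ∨ … ∨ a (σ (k-1)) form a maximal chain
-- with labels a (σ 0), …, a (σ (r-1)). Its descents are the adjacent inversions of σ, and the
-- edge of G_lex at the descent i leads to J (σ ∘ sᵢ), sᵢ the transposition of i and i+1: a rank 2
-- interval contains only one chain without descent, so the new middle element is forced.
-- Hence every path from J σ to A runs through such chains and removes one inversion per edge,
-- so the distance from J σ to A is the number of inversions of σ; the reversal has r C 2.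

module Submission where

open import Defs hiding (_⋖_)
open import Data.Nat
  using (ℕ; zero; suc; _+_; _∸_; _≤_; _<_; z≤n; s≤s; _≤′_; ≤′-refl; ≤′-step; _<?_)
open import Data.Nat.Properties
open import Data.Nat.Combinatorics using (_C_; nC1≡n; nCk+nC[k+1]≡[n+1]C[k+1])
open import Data.Nat.Tactic.RingSolver using (solve-∀)
open import Data.Fin as Fin using (Fin; toℕ)
open import Data.Fin.Properties using (all?; pigeonhole; toℕ<n)
open import Data.Product using (Σ; ∃; _×_; _,_; proj₁; proj₂)
open import Data.Sum using (_⊎_; inj₁; inj₂; [_,_]′)
open import Function using (_∘_)
open import Level using (0ℓ)
open import Relation.Nullary using (¬_; yes; no; contradiction)
open import Relation.Nullary.Decidable using (¬?; _×-dec_; decidable-stable)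
import Relation.Unary as U
open import Relation.Binary.Definitions using (Decidable; Tri; tri<; tri≈; tri>)
open import Relation.Binary.Lattice.Bundles using (BoundedLattice)
open import Relation.Binary.Lattice.Structures using (IsBoundedLattice)
import Relation.Binary.Lattice.Properties.JoinSemilattice as JoinSemilatticeProperties
open import Relation.Binary.PropositionalEquality
  using (_≡_; _≢_; refl; sym; trans; cong; cong₂; subst; subst₂; module ≡-Reasoning)
open import Algebra.Bundles using (CommutativeBand)
import Algebra.Properties.CommutativeSemigroup as CommutativeSemigroupProperties

subst₃ : ∀ {A : Set} (P : A → A → A → Set) {x x′ y y′ z z′} →
  x ≡ x′ → y ≡ y′ → z ≡ z′ → P x y z → P x′ y′ z′
subst₃ P refl refl refl p = p

open CommutativeSemigroupProperties +-commutativeSemigroup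
  using () renaming (xy∙z≈xz∙y to x+y+z≡x+z+y)

-- Permutations and inversions

swapAt : ℕ → ℕ → ℕ
swapAt zero    zero          = 1
swapAt zero    (suc zero)    = 0
swapAt zero    (suc (suc j)) = suc (suc j)
swapAt (suc i) zero          = zero
swapAt (suc i) (suc j)       = suc (swapAt i j)

swapAt-i : ∀ i → swapAt i i ≡ suc i
swapAt-i zero    = refl
swapAt-i (suc i) = cong suc (swapAt-i i)

swapAt-1+i : ∀ i → swapAt i (suc i) ≡ i
swapAt-1+i zero    = refl
swapAt-1+i (suc i) = cong suc (swapAt-1+i i)

swapAt-< : ∀ {i j} → j < i → swapAt i j ≡ j
swapAt-< {suc i} {zero}  _         = refl
swapAt-< {suc i} {suc j} (s≤s j<i) = cong suc (swapAt-< j<i)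

swapAt-> : ∀ {i j} → suc i < j → swapAt i j ≡ j
swapAt-> {zero}  {suc zero}    (s≤s ())
swapAt-> {zero}  {suc (suc j)} _           = refl
swapAt-> {suc i} {suc j}       (s≤s 1+i<j) = cong suc (swapAt-> 1+i<j)

swapAt-involutive : ∀ i j → swapAt i (swapAt i j) ≡ j
swapAt-involutive zero    zero          = refl
swapAt-involutive zero    (suc zero)    = refl
swapAt-involutive zero    (suc (suc j)) = refl
swapAt-involutive (suc i) zero          = refl
swapAt-involutive (suc i) (suc j)       = cong suc (swapAt-involutive i j)

swapAt-bounded : ∀ {i j r} → suc i < r → j < r → swapAt i j < r
swapAt-bounded {zero}  {zero}          1<r         _         = 1<r
swapAt-bounded {zero}  {suc zero}      _           2≤r       = ≤-trans (s≤s z≤n) 2≤r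
swapAt-bounded {zero}  {suc (suc j)}   _           j+2<r     = j+2<r
swapAt-bounded {suc i} {zero}          _           0<r       = 0<r
swapAt-bounded {suc i} {suc j} {suc r} (s≤s i+1<r) (s≤s j<r) = s≤s (swapAt-bounded i+1<r j<r)

sumBelow : ℕ → (ℕ → ℕ) → ℕ
sumBelow zero    f = 0
sumBelow (suc n) f = sumBelow n f + f n

sumBelow-cong : ∀ n {f g : ℕ → ℕ} → (∀ {j} → j < n → f j ≡ g j) →
  sumBelow n f ≡ sumBelow n g
sumBelow-cong zero    _  = refl
sumBelow-cong (suc n) eq = cong₂ _+_ (sumBelow-cong n (eq ∘ m<n⇒m<1+n)) (eq (n<1+n n))

sumBelow-zeros : ∀ n {f : ℕ → ℕ} → (∀ {j} → j < n → f j ≡ 0) → sumBelow n f ≡ 0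
sumBelow-zeros zero    _  = refl
sumBelow-zeros (suc n) eq = cong₂ _+_ (sumBelow-zeros n (eq ∘ m<n⇒m<1+n)) (eq (n<1+n n))

sumBelow-ones : ∀ n {f : ℕ → ℕ} → (∀ {j} → j < n → f j ≡ 1) → sumBelow n f ≡ n
sumBelow-ones zero    _  = refl
sumBelow-ones (suc n) eq =
  trans (cong₂ _+_ (sumBelow-ones n (eq ∘ m<n⇒m<1+n)) (eq (n<1+n n))) (+-comm n 1)

sumBelow-swapAt : ∀ i f {n} → suc i < n → sumBelow n (f ∘ swapAt i) ≡ sumBelow n f
sumBelow-swapAt i f = go ∘ ≤⇒≤′
  where
  go : ∀ {n} → suc (suc i) ≤′ n → sumBelow n (f ∘ swapAt i) ≡ sumBelow n f
  go ≤′-refl = begin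
      sumBelow i (f ∘ swapAt i) + f (swapAt i i) + f (swapAt i (suc i))
    ≡⟨ cong₂ _+_ (cong₂ _+_ (sumBelow-cong i (cong f ∘ swapAt-<)) (cong f (swapAt-i i)))
                 (cong f (swapAt-1+i i)) ⟩
      sumBelow i f + f (suc i) + f i
    ≡⟨ x+y+z≡x+z+y (sumBelow i f) (f (suc i)) (f i) ⟩
      sumBelow i f + f i + f (suc i)
    ∎
    where open ≡-Reasoning
  go (≤′-step le) = cong₂ _+_ (go le) (cong f (swapAt-> (≤′⇒≤ le)))

⟦_<_⟧ : ℕ → ℕ → ℕ
⟦ m < n ⟧ with m <? n
... | yes _ = 1
... | no  _ = 0

⟦<⟧-yes : ∀ {m n} → m < n → ⟦ m < n ⟧ ≡ 1
⟦<⟧-yes {m} {n} m<n with m <? n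
... | yes _   = refl
... | no  m≮n = contradiction m<n m≮n

⟦<⟧-no : ∀ {m n} → n ≤ m → ⟦ m < n ⟧ ≡ 0
⟦<⟧-no {m} {n} n≤m with m <? n
... | yes m<n = contradiction n≤m (<⇒≱ m<n)
... | no  _   = refl

inversionsAt : (ℕ → ℕ) → ℕ → ℕ
inversionsAt σ k = sumBelow k (λ j → ⟦ σ k < σ j ⟧)

inversions : (ℕ → ℕ) → ℕ → ℕ
inversions σ n = sumBelow n (inversionsAt σ)

inversions-cong : ∀ n {σ τ : ℕ → ℕ} → (∀ {j} → j < n → σ j ≡ τ j) →
  inversions σ n ≡ inversions τ n
inversions-cong n eq = sumBelow-cong n λ k<n → sumBelow-cong _ λ j<k →
  cong₂ ⟦_<_⟧ (eq k<n) (eq (<-trans j<k k<n))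

inversions-id : ∀ n → inversions (λ j → j) n ≡ 0
inversions-id n = sumBelow-zeros n λ {k} _ → sumBelow-zeros k λ j<k → ⟦<⟧-no (<⇒≤ j<k)

module _ {σ : ℕ → ℕ} {i : ℕ} where

  private
    σ′ : ℕ → ℕ
    σ′ = σ ∘ swapAt i

  inversionsAt-swapAt-i : inversionsAt σ′ i ≡ sumBelow i (λ j → ⟦ σ (suc i) < σ j ⟧)
  inversionsAt-swapAt-i = sumBelow-cong i λ j<i →
    cong₂ (λ k l → ⟦ σ k < σ l ⟧) (swapAt-i i) (swapAt-< j<i)

  inversionsAt-swapAt-1+i :
    inversionsAt σ′ (suc i) ≡ inversionsAt σ i + ⟦ σ i < σ (suc i) ⟧
  inversionsAt-swapAt-1+i = cong₂ _+_
    (sumBelow-cong i λ j<i → cong₂ (λ k l → ⟦ σ k < σ l ⟧) (swapAt-1+i i) (swapAt-< j<i))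
    (cong₂ (λ k l → ⟦ σ k < σ l ⟧) (swapAt-1+i i) (swapAt-i i))

  inversionsAt-swapAt-> : ∀ {k} → suc i < k → inversionsAt σ′ k ≡ inversionsAt σ k
  inversionsAt-swapAt-> {k} 1+i<k = trans
    (sumBelow-cong k λ _ → cong (λ l → ⟦ σ l < σ′ _ ⟧) (swapAt-> 1+i<k))
    (sumBelow-swapAt i (λ j → ⟦ σ k < σ j ⟧) 1+i<k)

  inversions-swapAt : σ (suc i) < σ i → ∀ {n} → suc i < n →
    inversions σ n ≡ suc (inversions σ′ n)
  inversions-swapAt desc = go ∘ ≤⇒≤′
    where
    I = inversions σ′ i
    P = inversionsAt σ i
    R = sumBelow i (λ j → ⟦ σ (suc i) < σ j ⟧)
    arith : ∀ a b c → a + b + (c + 1) ≡ suc (a + c + (b + 0))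
    arith = solve-∀
    go : ∀ {n} → suc (suc i) ≤′ n → inversions σ n ≡ suc (inversions σ′ n)
    go ≤′-refl = begin
        inversions σ i + P + (R + ⟦ σ (suc i) < σ i ⟧)
      ≡⟨ cong₂ (λ x y → x + P + (R + y))
               (inversions-cong i (sym ∘ cong σ ∘ swapAt-<)) (⟦<⟧-yes desc) ⟩
        I + P + (R + 1)
      ≡⟨ arith I P R ⟩
        suc (I + R + (P + 0))
      ≡⟨ cong (λ x → suc (I + R + (P + x))) (⟦<⟧-no (<⇒≤ desc)) ⟨
        suc (I + R + (P + ⟦ σ i < σ (suc i) ⟧))
      ≡⟨ cong suc (cong₂ (λ x y → I + x + y) inversionsAt-swapAt-i inversionsAt-swapAt-1+i) ⟨
        suc (inversions σ′ (suc (suc i)))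
      ∎
      where open ≡-Reasoning
    go (≤′-step le) = cong₂ _+_ (go le) (sym (inversionsAt-swapAt-> (≤′⇒≤ le)))

record IsPermutation (r : ℕ) (σ : ℕ → ℕ) : Set where
  field
    bounded   : ∀ {j} → j < r → σ j < r
    injective : ∀ {j k} → j < r → k < r → σ j ≡ σ k → j ≡ k

permutation-<⇒≢ : ∀ {r σ} → IsPermutation r σ → ∀ {j k} → j < k → k < r → σ j ≢ σ k
permutation-<⇒≢ perm j<k k<r eq =
  <⇒≢ j<k (IsPermutation.injective perm (<-trans j<k k<r) k<r eq)

swapAt-isPermutation : ∀ {r σ i} → suc i < r → IsPermutation r σ →
  IsPermutation r (σ ∘ swapAt i)
swapAt-isPermutation {i = i} 1+i<r perm = record
  { bounded   = bounded ∘ swapAt-bounded 1+i<r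
  ; injective = λ {j} {k} j<r k<r eq → begin
      j                       ≡⟨ swapAt-involutive i j ⟨
      swapAt i (swapAt i j)   ≡⟨ cong (swapAt i) (injective (swapAt-bounded 1+i<r j<r)
                                                            (swapAt-bounded 1+i<r k<r) eq) ⟩
      swapAt i (swapAt i k)   ≡⟨ swapAt-involutive i k ⟩
      k                       ∎
  }
  where open IsPermutation perm
        open ≡-Reasoning

Sorted : ℕ → (ℕ → ℕ) → Set
Sorted r σ = ∀ {i} → suc i < r → σ i ≤ σ (suc i)

descent-or-sorted : ∀ r σ → (∃ λ i → suc i < r × σ (suc i) < σ i) ⊎ Sorted r σ
descent-or-sorted r σ with anyUpTo? (λ i → (suc i <? r) ×-dec (σ (suc i) <? σ i)) r
... | yes (i , _ , desc) = inj₁ (i , desc)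
... | no  none           =
  inj₂ λ {i} 1+i<r → ≮⇒≥ λ desc → none (i , <-trans (n<1+n i) 1+i<r , 1+i<r , desc)

sorted-permutation⇒id : ∀ {r σ} → IsPermutation r σ → Sorted r σ → ∀ {j} → j < r → σ j ≡ j
sorted-permutation⇒id {r} {σ} perm sorted {j} j<r = ≤-antisym σj≤j (j≤σj j<r)
  where
  open IsPermutation perm
  increasing : ∀ {i} → suc i < r → σ i < σ (suc i)
  increasing {i} 1+i<r = ≤∧≢⇒< (sorted 1+i<r) (permutation-<⇒≢ perm (n<1+n i) 1+i<r)
  j≤σj : ∀ {j} → j < r → j ≤ σ j
  j≤σj {zero}  _     = z≤n
  j≤σj {suc j} 1+j<r = ≤-trans (s≤s (j≤σj (<-trans (n<1+n j) 1+j<r))) (increasing 1+j<r)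
  room : ∀ m {i} → i + m < r → σ i + m < r
  room zero    {i} i<r     =
    subst (_< r) (sym (+-identityʳ (σ i))) (bounded (subst (_< r) (+-identityʳ i) i<r))
  room (suc m) {i} i+1+m<r = begin-strict
      σ i + suc m     ≡⟨ +-suc (σ i) m ⟩
      suc (σ i) + m   ≤⟨ +-monoˡ-≤ m (increasing 1+i<r) ⟩
      σ (suc i) + m   <⟨ room m 1+i+m<r ⟩
      r               ∎
    where
    open ≤-Reasoning
    1+i+m<r = subst (_< r) (+-suc i m) i+1+m<r
    1+i<r   = ≤-<-trans (m≤m+n (suc i) m) 1+i+m<r
  t = r ∸ suc j
  fill : suc j + t ≡ r
  fill = m+[n∸m]≡n j<r
  σj≤j : σ j ≤ j
  σj≤j = ≤-pred (+-cancelʳ-< t (σ j) (suc j)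
           (subst (σ j + t <_) (sym fill) (room t (subst (j + t <_) fill (n<1+n (j + t))))))

inversions-sorted : ∀ {r σ} → IsPermutation r σ → Sorted r σ → inversions σ r ≡ 0
inversions-sorted {r} perm sorted =
  trans (inversions-cong r (sorted-permutation⇒id perm sorted)) (inversions-id r)

reverse : ℕ → ℕ → ℕ
reverse r j = r ∸ suc j

reverse-anti : ∀ {r j k} → j < k → k < r → reverse r k < reverse r j
reverse-anti j<k k<r = ∸-monoʳ-< (s≤s j<k) k<r

reverse-isPermutation : ∀ r → IsPermutation r (reverse r)
reverse-isPermutation r = record
  { bounded   = λ j<r → ∸-monoʳ-< (s≤s z≤n) j<r
  ; injective = injective
  }
  where
  injective : ∀ {j k} → j < r → k < r → reverse r j ≡ reverse r k → j ≡ k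
  injective {j} {k} j<r k<r eq with <-cmp j k
  ... | tri< j<k _ _ = contradiction (sym eq) (<⇒≢ (reverse-anti j<k k<r))
  ... | tri≈ _ j≡k _ = j≡k
  ... | tri> _ _ k<j = contradiction eq (<⇒≢ (reverse-anti k<j j<r))

reverse-involutive : ∀ {r p} → p < r → reverse r (reverse r p) ≡ p
reverse-involutive {r} p<r = trans (cong (r ∸_) (sym (+-∸-assoc 1 p<r))) (m∸[m∸n]≡n (<⇒≤ p<r))

inversions-reverse : ∀ r {n} → n ≤ r → inversions (reverse r) n ≡ n C 2
inversions-reverse r {zero}  _     = refl
inversions-reverse r {suc n} 1+n≤r = begin
    inversions (reverse r) n + inversionsAt (reverse r) n
  ≡⟨ cong₂ _+_ (inversions-reverse r (<⇒≤ 1+n≤r))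
               (sumBelow-ones n λ j<n → ⟦<⟧-yes (reverse-anti j<n 1+n≤r)) ⟩
    n C 2 + n
  ≡⟨ +-comm (n C 2) n ⟩
    n + n C 2
  ≡⟨ cong (_+ n C 2) (nC1≡n n) ⟨
    n C 1 + n C 2
  ≡⟨ nCk+nC[k+1]≡[n+1]C[k+1] n 1 ⟩
    suc n C 2
  ∎
  where open ≡-Reasoning

first-failure : ∀ {P : ℕ → Set} → U.Decidable P → ∀ m →
  (∀ {q} → q < m → P q) ⊎ (∃ λ K → (∀ {q} → q < K → P q) × ¬ P K)
first-failure P? zero = inj₁ λ ()
first-failure P? (suc m) with first-failure P? m
... | inj₂ failure = inj₂ failure
... | inj₁ below with P? m
...   | no  ¬Pm = inj₂ (m , below , ¬Pm)
...   | yes Pm  = inj₁ λ q<1+m → [ below , (λ { refl → Pm }) ]′ (m<1+n⇒m<n∨m≡n q<1+m)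

argmin? : ∀ {m} {P : Fin m → Set} → U.Decidable P → (f : Fin m → ℕ) →
  (∃ λ b → P b × ∀ {c} → P c → f b ≤ f c) ⊎ (∀ c → ¬ P c)
argmin? {zero}  P? f = inj₂ λ ()
argmin? {suc m} P? f with argmin? (P? ∘ Fin.suc) (f ∘ Fin.suc) | P? Fin.zero
... | inj₂ none | no ¬P0 = inj₂ λ { Fin.zero → ¬P0 ; (Fin.suc c) → none c }
... | inj₂ none | yes P0 =
  inj₁ (Fin.zero , P0 , λ { {Fin.zero} _ → ≤-refl ; {Fin.suc c} Pc → contradiction Pc (none c) })
... | inj₁ (b , Pb , least) | no ¬P0 =
  inj₁ (Fin.suc b , Pb , λ { {Fin.zero} P0 → contradiction P0 ¬P0 ; {Fin.suc c} Pc → least Pc })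
... | inj₁ (b , Pb , least) | yes P0 with f Fin.zero ≤? f (Fin.suc b)
...   | yes f0≤fb =
  inj₁ (Fin.zero , P0 , λ { {Fin.zero} _ → ≤-refl ; {Fin.suc c} Pc → ≤-trans f0≤fb (least Pc) })
...   | no  f0≰fb =
  inj₁ (Fin.suc b , Pb , λ { {Fin.zero} _ → <⇒≤ (≰⇒> f0≰fb) ; {Fin.suc c} Pc → least Pc })

-- Finite lattices

module _ (L : FinLattice) where
  open FinLattice L renaming (_≤_ to infix 4 _⊑_; _∨_ to infixr 6 _∨_; _∧_ to infixr 7 _∧_)
  open IsBoundedLattice isBoundedLattice
    using (x≤x∨y; y≤x∨y; ∨-least; x∧y≤x; x∧y≤y; maximum; minimum)
    renaming (refl to ⊑-refl; trans to ⊑-trans; antisym to ⊑-antisym)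

  infix 4 _⋖_
  _⋖_ : Elt L → Elt L → Set
  _⋖_ = Defs._⋖_ L

  private
    boundedLattice : BoundedLattice 0ℓ 0ℓ 0ℓ
    boundedLattice = record
      { Carrier = Elt L ; _≈_ = _≡_ ; _≤_ = _⊑_ ; _∨_ = _∨_ ; _∧_ = _∧_ ; ⊤ = ⊤ ; ⊥ = ⊥
      ; isBoundedLattice = isBoundedLattice
      }

  open JoinSemilatticeProperties (BoundedLattice.joinSemilattice boundedLattice)
    using (∨-monotonic; ≈-dec⇒≤-dec; isAlgSemilattice)

  private
    ∨-commutativeBand : CommutativeBand 0ℓ 0ℓ
    ∨-commutativeBand = record { isCommutativeBand = isAlgSemilattice }

  open CommutativeSemigroupProperties (CommutativeBand.commutativeSemigroup ∨-commutativeBand)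
    using () renaming (x∙yz≈y∙xz to x∨y∨z≡y∨x∨z)

  _⊑?_ : Decidable _⊑_
  _⊑?_ = ≈-dec⇒≤-dec Fin._≟_

  ⋖-between : ∀ {x y z} → x ⋖ y → x ⊑ z → x ≢ z → z ⊑ y → z ≡ y
  ⋖-between {y = y} {z} (_ , nothing-between) x⊑z x≢z z⊑y with z Fin.≟ y
  ... | yes z≡y = z≡y
  ... | no  z≢y = contradiction (z⊑y , z≢y) (nothing-between z (x⊑z , x≢z))

  atom∧≡⊥ : ∀ {a x} → IsAtom L a → ¬ a ⊑ x → a ∧ x ≡ ⊥
  atom∧≡⊥ {a} {x} (_ , nothing-between) a⋢x with (a ∧ x) Fin.≟ ⊥ | (a ∧ x) Fin.≟ a
  ... | yes a∧x≡⊥ | _         = a∧x≡⊥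
  ... | no  _     | yes a∧x≡a = contradiction (subst (_⊑ x) a∧x≡a (x∧y≤y a x)) a⋢x
  ... | no  a∧x≢⊥ | no  a∧x≢a =
    contradiction (x∧y≤x a x , a∧x≢a) (nothing-between (a ∧ x) (minimum _ , a∧x≢⊥ ∘ sym))

  IsAtom? : U.Decidable (IsAtom L)
  IsAtom? a with ⊥ Fin.≟ a
  ... | yes ⊥≡a = no λ ((_ , ⊥≢a) , _) → ⊥≢a ⊥≡a
  ... | no  ⊥≢a with all? (λ z → ¬? (((⊥ ⊑? z) ×-dec ¬? (⊥ Fin.≟ z))
                                   ×-dec ((z ⊑? a) ×-dec ¬? (z Fin.≟ a))))
  ...   | yes nothing-between =
    yes ((minimum a , ⊥≢a) , λ z ⊥<z z<a → nothing-between z (⊥<z , z<a))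
  ...   | no  something-between =
    no λ (_ , nothing-between) → something-between λ z (⊥<z , z<a) → nothing-between z ⊥<z z<a

  module _ (semimodular : Semimodular L) where

    ⋖-∨-atom : ∀ {a x} → IsAtom L a → ¬ a ⊑ x → x ⋖ a ∨ x
    ⋖-∨-atom {a} {x} atom a⋢x =
      semimodular a x (subst (_⋖ a) (sym (atom∧≡⊥ atom a⋢x)) atom)

    exchange : ∀ {a b x} → IsAtom L a → b ⊑ a ∨ x → ¬ b ⊑ x → a ⊑ b ∨ x
    exchange {a} {b} {x} atom b⊑a∨x b⋢x = subst (a ⊑_) a∨x≡b∨x (x≤x∨y a x)
      where
      a⋢x : ¬ a ⊑ x
      a⋢x a⊑x = b⋢x (⊑-trans b⊑a∨x (∨-least a⊑x ⊑-refl))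
      a∨x≡b∨x : a ∨ x ≡ b ∨ x
      a∨x≡b∨x = sym (⋖-between (⋖-∨-atom atom a⋢x) (y≤x∨y b x)
                       (λ x≡b∨x → b⋢x (subst (b ⊑_) (sym x≡b∨x) (x≤x∨y b x)))
                       (∨-least b⊑a∨x (y≤x∨y a x)))

  -- Minimal labelings

  module _ {ord : Elt L → ℕ} (ao : AtomOrder L ord) where
    open Labels L ord

    label-unique : ∀ {u v a b} → Label u v a → Label u v b → a ≡ b
    label-unique (atom-a , a⊑v , a⋢u , a-least) (atom-b , b⊑v , b⋢u , b-least) =
      ao _ _ atom-a atom-b (≤-antisym (a-least _ atom-b b⊑v b⋢u) (b-least _ atom-a a⊑v a⋢u))

    noDescent⇒¬descent : ∀ {u v w} → NoDescent u v w → ¬ Descent u v w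
    noDescent⇒¬descent (a , b , la , lb , a≤b) (a′ , b′ , la′ , lb′ , b′<a′) = <⇒≱
      (subst₂ _<_ (cong ord (label-unique lb′ lb)) (cong ord (label-unique la′ la)) b′<a′) a≤b

    label-join : ∀ {u v a} → u ⋖ v → Label u v a → a ∨ u ≡ v
    label-join u⋖v@((u⊑v , _) , _) (_ , a⊑v , a⋢u , _) = ⋖-between u⋖v (y≤x∨y _ _)
      (λ u≡a∨u → a⋢u (subst (_ ⊑_) (sym u≡a∨u) (x≤x∨y _ _))) (∨-least a⊑v u⊑v)

    noDescent-label : ∀ {u v w a b} → v ⊑ w → Label u v a → Label v w b → ord a ≤ ord b →
      Label u w a
    noDescent-label {u} {v} {w} {a} v⊑w (atom-a , a⊑v , a⋢u , a-least) (_ , _ , _ , b-least) a≤b =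
      atom-a , ⊑-trans a⊑v v⊑w , a⋢u , least
      where
      least : ∀ c → IsAtom L c → c ⊑ w → ¬ c ⊑ u → ord a ≤ ord c
      least c atom-c c⊑w c⋢u with c ⊑? v
      ... | yes c⊑v = a-least c atom-c c⊑v c⋢u
      ... | no  c⋢v = ≤-trans a≤b (b-least c atom-c c⊑w c⋢v)

    noDescent-middle-unique : ∀ {u v v′ w} → u ⋖ v → v ⊑ w → u ⋖ v′ → v′ ⊑ w →
      NoDescent u v w → NoDescent u v′ w → v ≡ v′
    noDescent-middle-unique {u} {v} {v′} u⋖v v⊑w u⋖v′ v′⊑w
                            (a , _ , la , lb , a≤b) (a′ , _ , la′ , lb′ , a′≤b′) = begin
      v      ≡⟨ label-join u⋖v la ⟨
      a ∨ u  ≡⟨ cong (_∨ u) (label-unique (noDescent-label v⊑w la lb a≤b)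
                                          (noDescent-label v′⊑w la′ lb′ a′≤b′)) ⟩
      a′ ∨ u ≡⟨ label-join u⋖v′ la′ ⟩
      v′     ∎
      where open ≡-Reasoning

  -- The ascending chain and the chains J σ

  module AscendingDistance (geometric : Geometric L) (r : ℕ) (rank : HasRank L r)
                           (ord : Elt L → ℕ) (ao : AtomOrder L ord) where
    open Labels L ord
    open Graph r

    private
      atomic      = proj₁ geometric
      semimodular = proj₂ geometric

    NewAtom : Elt L → Elt L → Set
    NewAtom x c = IsAtom L c × ¬ c ⊑ x

    HasNewAtom : Elt L → Set
    HasNewAtom x = ∃ (NewAtom x)

    LeastNewAtom : Elt L → Elt L → Set
    LeastNewAtom x a = NewAtom x a × (∀ {c} → NewAtom x c → ord a ≤ ord c)

    leastNewAtom? : ∀ x → ∃ (LeastNewAtom x) ⊎ (∀ c → ¬ NewAtom x c)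
    leastNewAtom? x = argmin? (λ c → IsAtom? c ×-dec ¬? (c ⊑? x)) ord

    hasNewAtom? : U.Decidable HasNewAtom
    hasNewAtom? x with leastNewAtom? x
    ... | inj₁ (a , new , _) = yes (a , new)
    ... | inj₂ none          = no λ (c , new) → none c new

    -- ⊥ is a junk value, returned only when every atom is already below x.
    nextAtom : Elt L → Elt L
    nextAtom x with leastNewAtom? x
    ... | inj₁ (a , _) = a
    ... | inj₂ _       = ⊥

    nextAtom-least : ∀ {x} → HasNewAtom x → LeastNewAtom x (nextAtom x)
    nextAtom-least {x} (c , new) with leastNewAtom? x
    ... | inj₁ (_ , least) = least
    ... | inj₂ none        = contradiction new (none c)

    A : ℕ → Elt L
    a : ℕ → Elt L
    A zero    = ⊥
    A (suc k) = a k ∨ A k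
    a k = nextAtom (A k)

    A-mono : ∀ {p q} → p ≤ q → A p ⊑ A q
    A-mono = go ∘ ≤⇒≤′
      where
      go : ∀ {p q} → p ≤′ q → A p ⊑ A q
      go ≤′-refl       = ⊑-refl
      go (≤′-step p≤q) = ⊑-trans (go p≤q) (y≤x∨y _ _)

    a⊑A : ∀ {q p} → q < p → a q ⊑ A p
    a⊑A q<p = ⊑-trans (x≤x∨y _ _) (A-mono q<p)

    A-least : ∀ {p x} → (∀ {q} → q < p → a q ⊑ x) → A p ⊑ x
    A-least {zero}  _     = minimum _
    A-least {suc p} below = ∨-least (below (n<1+n p)) (A-least (below ∘ m<n⇒m<1+n))

    A-distinct : ∀ {i j} → (∀ {q} → q < j → HasNewAtom (A q)) → i < j → A i ≢ A j
    A-distinct {i} new i<j Ai≡Aj =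
      proj₂ (proj₁ (nextAtom-least (new i<j))) (subst (a i ⊑_) (sym Ai≡Aj) (a⊑A i<j))

    A-stops : ∃ λ K → (∀ {q} → q < K → HasNewAtom (A q)) × ¬ HasNewAtom (A K)
    A-stops with first-failure (hasNewAtom? ∘ A) (suc n)
    ... | inj₂ stop = stop
    ... | inj₁ new  with pigeonhole (n<1+n n) (A ∘ toℕ)
    ...   | i , j , i<j , Ai≡Aj =
      contradiction Ai≡Aj (A-distinct (λ q<j → new (<-trans q<j (toℕ<n j))) i<j)

    K : ℕ
    K = proj₁ A-stops

    new-below-K : ∀ {q} → q < K → HasNewAtom (A q)
    new-below-K = proj₁ (proj₂ A-stops)

    no-new-at-K : ¬ HasNewAtom (A K)
    no-new-at-K = proj₂ (proj₂ A-stops)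

    A-K≡⊤ : A K ≡ ⊤
    A-K≡⊤ = ⊑-antisym (maximum _) (atomic ⊤ (A K) λ c atom-c _ →
      decidable-stable (c ⊑? A K) λ c⋢A → no-new-at-K (c , atom-c , c⋢A))

    K≡r : K ≡ r
    K≡r = proj₂ rank K A (refl , A-K≡⊤ , λ q q<K →
      let (atom , a⋢A) , _ = nextAtom-least (new-below-K q<K) in ⋖-∨-atom semimodular atom a⋢A)

    A-r≡⊤ : A r ≡ ⊤
    A-r≡⊤ = subst (λ k → A k ≡ ⊤) K≡r A-K≡⊤

    a-least : ∀ {q} → q < r → LeastNewAtom (A q) (a q)
    a-least q<r = nextAtom-least (new-below-K (subst (_ <_) (sym K≡r) q<r))

    a-atom : ∀ {q} → q < r → IsAtom L (a q)
    a-atom = proj₁ ∘ proj₁ ∘ a-least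

    a⋢A : ∀ {q} → q < r → ¬ a q ⊑ A q
    a⋢A = proj₂ ∘ proj₁ ∘ a-least

    ord-a-< : ∀ {p q} → p < q → q < r → ord (a p) < ord (a q)
    ord-a-< {p} {q} p<q q<r = ≤∧≢⇒< (proj₂ (a-least p<r) (a-atom q<r , aq⋢Ap)) ap≢aq
      where
      p<r = <-trans p<q q<r
      aq⋢Ap : ¬ a q ⊑ A p
      aq⋢Ap aq⊑Ap = a⋢A q<r (⊑-trans aq⊑Ap (A-mono (<⇒≤ p<q)))
      ap≢aq : ord (a p) ≢ ord (a q)
      ap≢aq eq = a⋢A q<r (subst (_⊑ A q) (ao _ _ (a-atom p<r) (a-atom q<r) eq) (a⊑A p<q))

    ord-a-≤ : ∀ {p q} → p ≤ q → q < r → ord (a p) ≤ ord (a q)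
    ord-a-≤ p≤q q<r with m≤n⇒m<n∨m≡n p≤q
    ... | inj₁ p<q  = <⇒≤ (ord-a-< p<q q<r)
    ... | inj₂ refl = ≤-refl

    a-label : ∀ {q} → q < r → Label (A q) (A (suc q)) (a q)
    a-label q<r =
      a-atom q<r , x≤x∨y _ _ , a⋢A q<r , λ c atom-c _ c⋢A → proj₂ (a-least q<r) (atom-c , c⋢A)

    A-ascending : Ascending A
    A-ascending = (refl , A-r≡⊤ , λ q q<r → ⋖-∨-atom semimodular (a-atom q<r) (a⋢A q<r))
                , λ i 1+i<r → a i , a (suc i) , a-label (<-trans (n<1+n i) 1+i<r) , a-label 1+i<r
                            , ord-a-≤ (n≤1+n i) 1+i<r

    J : (ℕ → ℕ) → Chain L
    J σ zero    = ⊥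
    J σ (suc k) = a (σ k) ∨ J σ k

    J-cong : ∀ {σ τ} k → (∀ {j} → j < k → σ j ≡ τ j) → J σ k ≡ J τ k
    J-cong zero    _  = refl
    J-cong (suc k) eq = cong₂ _∨_ (cong a (eq (n<1+n k))) (J-cong k (eq ∘ m<n⇒m<1+n))

    J-id : ∀ k → J (λ j → j) k ≡ A k
    J-id zero    = refl
    J-id (suc k) = cong (a k ∨_) (J-id k)

    a⊑J : ∀ {σ j k} → j < k → a (σ j) ⊑ J σ k
    a⊑J {k = suc k} j<1+k with m<1+n⇒m<n∨m≡n j<1+k
    ... | inj₁ j<k  = ⊑-trans (a⊑J j<k) (y≤x∨y _ _)
    ... | inj₂ refl = x≤x∨y _ _

    module _ {σ : ℕ → ℕ} {i : ℕ} where

      J-swapAt-≤ : ∀ {k} → k ≤ i → J (σ ∘ swapAt i) k ≡ J σ k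
      J-swapAt-≤ {k} k≤i = J-cong k λ j<k → cong σ (swapAt-< (<-≤-trans j<k k≤i))

      J-swapAt-> : ∀ {k} → suc i < k → J (σ ∘ swapAt i) k ≡ J σ k
      J-swapAt-> = go ∘ ≤⇒≤′
        where
        open ≡-Reasoning
        go : ∀ {k} → suc (suc i) ≤′ k → J (σ ∘ swapAt i) k ≡ J σ k
        go ≤′-refl = begin
            a (σ (swapAt i (suc i))) ∨ a (σ (swapAt i i)) ∨ J (σ ∘ swapAt i) i
          ≡⟨ cong₂ (λ x y → a (σ x) ∨ a (σ y) ∨ J (σ ∘ swapAt i) i) (swapAt-1+i i) (swapAt-i i) ⟩
            a (σ i) ∨ a (σ (suc i)) ∨ J (σ ∘ swapAt i) i
          ≡⟨ cong (λ z → a (σ i) ∨ a (σ (suc i)) ∨ z) (J-swapAt-≤ ≤-refl) ⟩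
            a (σ i) ∨ a (σ (suc i)) ∨ J σ i
          ≡⟨ x∨y∨z≡y∨x∨z _ _ _ ⟩
            a (σ (suc i)) ∨ a (σ i) ∨ J σ i
          ∎
        go (≤′-step le) = cong₂ _∨_ (cong (a ∘ σ) (swapAt-> (≤′⇒≤ le))) (go le)

      J-swapAt-≢ : ∀ {k} → k ≢ suc i → J (σ ∘ swapAt i) k ≡ J σ k
      J-swapAt-≢ {k} k≢1+i with <-cmp k (suc i)
      ... | tri< k<1+i _ _ = J-swapAt-≤ (≤-pred k<1+i)
      ... | tri≈ _ k≡1+i _ = contradiction k≡1+i k≢1+i
      ... | tri> _ _ 1+i<k = J-swapAt-> 1+i<k

    -- If σ k > p, exchanging a p for a (σ k) reduces the claim to the atom a (σ k).
    a-independent : ∀ {σ} → IsPermutation r σ → ∀ {k} → k ≤ r → ∀ {p} → p < r →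
      (∀ {j} → j < k → σ j ≢ p) → ¬ a p ⊑ A p ∨ J σ k
    a-independent _ {zero} _ p<r _ a⊑ = a⋢A p<r (⊑-trans a⊑ (∨-least ⊑-refl (minimum _)))
    a-independent {σ} perm {suc k} k<r {p} p<r fresh =
      by-cases (<-cmp (σ k) p) ∘ subst (a p ⊑_) (x∨y∨z≡y∨x∨z _ _ _)
      where
      open IsPermutation perm
      IH : ¬ a p ⊑ A p ∨ J σ k
      IH = a-independent perm (<⇒≤ k<r) p<r (fresh ∘ m<n⇒m<1+n)
      by-cases : Tri (σ k < p) (σ k ≡ p) (p < σ k) → ¬ a p ⊑ a (σ k) ∨ A p ∨ J σ k
      by-cases (tri< σk<p _ _) a⊑ =
        IH (⊑-trans a⊑ (∨-least (⊑-trans (a⊑A σk<p) (x≤x∨y _ _)) ⊑-refl))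
      by-cases (tri≈ _ σk≡p _) _  = fresh (n<1+n k) σk≡p
      by-cases (tri> _ _ p<σk) a⊑ =
        a-independent perm (<⇒≤ k<r) (bounded k<r) (λ j<k → permutation-<⇒≢ perm j<k k<r)
          (⊑-trans (exchange semimodular (a-atom (bounded k<r)) a⊑ IH)
                   (∨-least (⊑-trans (a⊑A p<σk) (x≤x∨y _ _)) (∨-monotonic (A-mono (<⇒≤ p<σk)) ⊑-refl)))

    module _ {σ : ℕ → ℕ} (perm : IsPermutation r σ) where
      open IsPermutation perm

      a⋢A∨J : ∀ {k} → k < r → ¬ a (σ k) ⊑ A (σ k) ∨ J σ k
      a⋢A∨J k<r = a-independent perm (<⇒≤ k<r) (bounded k<r) λ j<k → permutation-<⇒≢ perm j<k k<r

      a⋢J : ∀ {k} → k < r → ¬ a (σ k) ⊑ J σ k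
      a⋢J k<r a⊑J = a⋢A∨J k<r (⊑-trans a⊑J (y≤x∨y _ _))

      J-label : ∀ {k} → k < r → Label (J σ k) (J σ (suc k)) (a (σ k))
      J-label {k} k<r = a-atom (bounded k<r) , x≤x∨y _ _ , a⋢J k<r , least
        where
        least : ∀ c → IsAtom L c → c ⊑ J σ (suc k) → ¬ c ⊑ J σ k → ord (a (σ k)) ≤ ord c
        least c atom-c c⊑ c⋢ with c ⊑? A (σ k)
        ... | no  c⋢A = proj₂ (a-least (bounded k<r)) (atom-c , c⋢A)
        ... | yes c⊑A = contradiction
          (⊑-trans (exchange semimodular (a-atom (bounded k<r)) c⊑ c⋢) (∨-monotonic c⊑A ⊑-refl))
          (a⋢A∨J k<r)

      J-⋖ : ∀ {k} → k < r → J σ k ⋖ J σ (suc k)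
      J-⋖ k<r = ⋖-∨-atom semimodular (a-atom (bounded k<r)) (a⋢J k<r)

      J-isMaxChain : J σ r ≡ ⊤ → IsMaxChain L r (J σ)
      J-isMaxChain top = refl , top , λ _ → J-⋖

      J-descent : ∀ {i} → suc i < r → σ (suc i) < σ i →
        Descent (J σ i) (J σ (suc i)) (J σ (suc (suc i)))
      J-descent {i} 1+i<r desc = a (σ i) , a (σ (suc i))
        , J-label (<-trans (n<1+n i) 1+i<r) , J-label 1+i<r
        , ord-a-< desc (bounded (<-trans (n<1+n i) 1+i<r))

      J-noDescent : ∀ {i} → suc i < r → σ i ≤ σ (suc i) →
        NoDescent (J σ i) (J σ (suc i)) (J σ (suc (suc i)))
      J-noDescent {i} 1+i<r asc = a (σ i) , a (σ (suc i))
        , J-label (<-trans (n<1+n i) 1+i<r) , J-label 1+i<r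
        , ord-a-≤ asc (bounded 1+i<r)

      J-sorted : Sorted r σ → SameChain (J σ) A
      J-sorted sorted k k≤r =
        trans (J-cong k λ j<k → sorted-permutation⇒id perm sorted (<-≤-trans j<k k≤r)) (J-id k)

      J≐A⇒sorted : SameChain (J σ) A → Sorted r σ
      J≐A⇒sorted J≐A {i} 1+i<r = ≮⇒≥ λ desc →
        noDescent⇒¬descent ao (proj₂ A-ascending i 1+i<r)
          (subst₃ Descent (J≐A i (<⇒≤ (<-trans (n<1+n i) 1+i<r))) (J≐A (suc i) (<⇒≤ 1+i<r))
                          (J≐A (suc (suc i)) 1+i<r)
            (J-descent 1+i<r desc))

    module _ {σ : ℕ → ℕ} {i : ℕ} (perm : IsPermutation r σ) (1+i<r : suc i < r)
             (desc : σ (suc i) < σ i) where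

      J-swapAt-noDescent : NoDescent (J σ i) (J (σ ∘ swapAt i) (suc i)) (J σ (suc (suc i)))
      J-swapAt-noDescent =
        subst₂ (λ u w → NoDescent u (J (σ ∘ swapAt i) (suc i)) w)
          (J-swapAt-≤ {σ} {i} ≤-refl) (J-swapAt-> {σ} {i} ≤-refl)
          (J-noDescent (swapAt-isPermutation 1+i<r perm) 1+i<r
            (subst₂ (λ x y → σ x ≤ σ y) (sym (swapAt-i i)) (sym (swapAt-1+i i)) (<⇒≤ desc)))

      edge-swapAt : J σ r ≡ ⊤ → Edge (J σ) (J (σ ∘ swapAt i))
      edge-swapAt top = i , 1+i<r , J-descent perm 1+i<r desc
        , J-isMaxChain (swapAt-isPermutation 1+i<r perm) (trans (J-swapAt-> 1+i<r) top)
        , (λ _ _ → J-swapAt-≢) , J-swapAt-noDescent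

    edge-from-J : ∀ {σ c c′} → IsPermutation r σ → SameChain c (J σ) → Edge c c′ →
      ∃ λ i → suc i < r × σ (suc i) < σ i × SameChain c′ (J (σ ∘ swapAt i))
    edge-from-J {σ} {c} {c′} perm c≐J (i , 1+i<r , c-desc , (_ , _ , c′-⋖) , c′≐c , c′-noDesc) =
      i , 1+i<r , desc , c′≐J′
      where
      i<r = <-trans (n<1+n i) 1+i<r
      σ′ = σ ∘ swapAt i
      perm′ = swapAt-isPermutation 1+i<r perm
      cᵢ≡ : c i ≡ J σ i
      cᵢ≡ = c≐J i (<⇒≤ i<r)
      c₂≡ : c (suc (suc i)) ≡ J σ (suc (suc i))
      c₂≡ = c≐J (suc (suc i)) 1+i<r
      desc : σ (suc i) < σ i
      desc = ≰⇒> λ asc → noDescent⇒¬descent ao (J-noDescent perm 1+i<r asc)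
        (subst₃ Descent cᵢ≡ (c≐J (suc i) (<⇒≤ 1+i<r)) c₂≡ c-desc)
      c′-cover : J σ i ⋖ c′ (suc i)
      c′-cover = subst (_⋖ c′ (suc i)) (trans (c′≐c i (<⇒≤ i<r) (<⇒≢ (n<1+n i))) cᵢ≡) (c′-⋖ i i<r)
      c′-below : c′ (suc i) ⊑ J σ (suc (suc i))
      c′-below = subst (c′ (suc i) ⊑_) (trans (c′≐c (suc (suc i)) 1+i<r 1+n≢n) c₂≡)
                   (proj₁ (proj₁ (c′-⋖ (suc i) 1+i<r)))
      J′-cover : J σ i ⋖ J σ′ (suc i)
      J′-cover = subst (_⋖ J σ′ (suc i)) (J-swapAt-≤ {σ} {i} ≤-refl) (J-⋖ perm′ i<r)
      J′-below : J σ′ (suc i) ⊑ J σ (suc (suc i))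
      J′-below = subst (J σ′ (suc i) ⊑_) (J-swapAt-> {σ} {i} ≤-refl) (y≤x∨y _ _)
      middle : c′ (suc i) ≡ J σ′ (suc i)
      middle = noDescent-middle-unique ao c′-cover c′-below J′-cover J′-below
        (subst₂ (λ u w → NoDescent u (c′ (suc i)) w) cᵢ≡ c₂≡ c′-noDesc)
        (J-swapAt-noDescent perm 1+i<r desc)
      c′≐J′ : SameChain c′ (J σ′)
      c′≐J′ k k≤r with k ≟ suc i
      ... | yes refl  = middle
      ... | no  k≢1+i = trans (c′≐c k k≤r k≢1+i) (trans (c≐J k k≤r) (sym (J-swapAt-≢ k≢1+i)))

    inversions≤length : ∀ {c d} → Path c A d → ∀ {σ} → IsPermutation r σ → SameChain c (J σ) →
      inversions σ r ≤ d
    inversions≤length (here c≐A) perm c≐J = ≤-reflexive (inversions-sorted perm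
      (J≐A⇒sorted perm λ k k≤r → trans (sym (c≐J k k≤r)) (c≐A k k≤r)))
    inversions≤length (step {k = d} edge path) {σ} perm c≐J with edge-from-J perm c≐J edge
    ... | i , 1+i<r , desc , c′≐J′ = begin
        inversions σ r                     ≡⟨ inversions-swapAt desc 1+i<r ⟩
        suc (inversions (σ ∘ swapAt i) r)  ≤⟨ s≤s (inversions≤length path
                                                (swapAt-isPermutation 1+i<r perm) c′≐J′) ⟩
        suc d                              ∎
      where open ≤-Reasoning

    path-from-J : ∀ d {σ} → IsPermutation r σ → J σ r ≡ ⊤ → inversions σ r ≡ d → Path (J σ) A d
    path-from-J d {σ} perm top inv≡d with descent-or-sorted r σ
    ... | inj₂ sorted = subst (Path (J σ) A) (trans (sym (inversions-sorted perm sorted)) inv≡d)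
                          (here (J-sorted perm sorted))
    ... | inj₁ (i , 1+i<r , desc) with d | trans (sym (inversions-swapAt desc 1+i<r)) inv≡d
    ...   | zero   | ()
    ...   | suc d′ | 1+inv≡1+d′ = step (edge-swapAt perm 1+i<r desc top)
      (path-from-J d′ (swapAt-isPermutation 1+i<r perm) (trans (J-swapAt-> 1+i<r) top)
                      (suc-injective 1+inv≡1+d′))

    J-reverse-top : J (reverse r) r ≡ ⊤
    J-reverse-top = ⊑-antisym (maximum _) (subst (_⊑ J (reverse r) r) A-r≡⊤ (A-least λ q<r →
      subst (λ p → a p ⊑ J (reverse r) r) (reverse-involutive q<r)
        (a⊑J (IsPermutation.bounded (reverse-isPermutation r) q<r))))

mainTheorem8 : (L : FinLattice) → Geometric L → (r : ℕ) → HasRank L r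
    → (ord : Elt L → ℕ) → AtomOrder L ord
    → Σ (Chain L) λ M → IsMaxChain L r M
      × Σ (Chain L) λ A → Labels.Graph.Ascending L ord r A
        × Labels.Graph.Dist L ord r M A (r C 2)
mainTheorem8 L geometric r rank ord ao =
    J ρ , J-isMaxChain ρ-isPermutation J-reverse-top
  , A , A-ascending
  , path-from-J (r C 2) ρ-isPermutation J-reverse-top ρ-inversions
  , λ d path → subst (_≤ d) ρ-inversions (inversions≤length path ρ-isPermutation λ _ _ → refl)
  where
  open AscendingDistance L geometric r rank ord ao
  ρ = reverse r
  ρ-isPermutation = reverse-isPermutation r
  ρ-inversions : inversions ρ r ≡ r C 2
  ρ-inversions = inversions-reverse r ≤-refl
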